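{- Let $z\in I_\mathbb{Z}$ and $a=a_1a_2\cdots a_n\in\mathcal{R}_{\mathrm{inv}}(z)$. Then the map $i\mapsto\gamma_i(a)$ is a bijection from the set of commutation indices of $a$ to $\mathrm{cyc}(z)$.
   Context: $S_\mathbb{Z}$ is the group of finitely supported permutations of $\mathbb{Z}$, $s_i=(i,i+1)$; the Demazure product $\circ$ is the unique associative product on $S_\mathbb{Z}$ with $\sigma\circ s_i=\sigma$ if $\sigma(i)>\sigma(i+1)$ and $\sigma\circ s_i=\sigma s_i$ otherwise. $I_\mathbb{Z}=\{z\in S_\mathbb{Z}:z=z^{ -1}\}$. For $z\in I_\mathbb{Z}$, $\mathcal{R}_{\mathrm{inv}}(z)$ is the set of integer words $a_1\cdots a_n$ of minimal length with $z=s_{a_n}\circ\cdots\circ s_{a_2}\circ s_{a_1}\circ s_{a_2}\circ\cdots\circ s_{a_n}$. An index $i\in[n]$ is a commutation of $a$ if $s_{a_i}$ commutes with $s_{a_{i-1}}\circ\cdots\circ s_{a_1}\circ\cdots\circ s_{a_{i-1}}$. $\mathrm{cyc}(z)=\{\{i,j\}:i<j=z(i)\}$ is the set of 2-cycles of $z$. For $i\in[n]$, $\gamma_i(a):=s_{a_n}\cdots s_{a_{i+2}}s_{a_{i+1}}(\{a_i,1+a_i\})$ (ordinary product of permutations applied elementwise to the 2-element set) if $i$ is a commutation of $a$, and $\gamma_i(a):=\emptyset$ otherwise. -}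

module Defs where

open import Data.Integer using (ℤ; _+_; _<_; _<?_; _≟_; +_)
open import Data.Nat using (ℕ) renaming (_≤_ to _≤ℕ_; _+_ to _+ℕ_)
open import Data.List using (List; []; _∷_; foldl; reverse; _++_; drop; take; length; lookup)
open import Data.List.Membership.Propositional using (_∈_)
open import Data.Fin using (Fin; toℕ)
open import Data.Product using (_×_; _,_; ∃)
open import Relation.Nullary using (¬_; yes; no)
open import Relation.Binary.PropositionalEquality using (_≡_)

Perm : Set
Perm = ℤ → ℤ

idP : Perm
idP x = x

_≐_ : Perm → Perm → Set
σ ≐ τ = ∀ x → σ x ≡ τ x

s : ℤ → Perm
s i x with x ≟ i
... | yes _ = i + + 1
... | no _ with x ≟ i + + 1
...   | yes _ = i
...   | no _ = x

demStep : Perm → ℤ → Perm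
demStep σ i with σ (i + + 1) <? σ i
... | yes _ = σ
... | no _ = λ x → σ (s i x)

dem : List ℤ → Perm
dem w = foldl demStep idP w

invWord : List ℤ → List ℤ
invWord a = reverse a ++ drop 1 a

invDem : List ℤ → Perm
invDem a = dem (invWord a)

FinSupp : Perm → Set
FinSupp σ = ∃ λ (L : List ℤ) → ∀ x → ¬ (x ∈ L) → σ x ≡ x

IsInvolutionZ : Perm → Set
IsInvolutionZ z = (∀ x → z (z x) ≡ x) × FinSupp z

Rinv : Perm → List ℤ → Set
Rinv z a = (invDem a ≐ z) × (∀ b → invDem b ≐ z → length a ≤ℕ length b)

-- position i (0-based; corresponds to index toℕ i + 1 in [n]) is a commutation of a:
-- s_{a_i} commutes with s_{a_{i-1}} ∘ ⋯ ∘ s_{a_1} ∘ ⋯ ∘ s_{a_{i-1}}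
IsCommutation : (a : List ℤ) → Fin (length a) → Set
IsCommutation a i = ∀ x → s (lookup a i) (τ x) ≡ τ (s (lookup a i) x)
  where
  τ : Perm
  τ = invDem (take (toℕ i) a)

-- ordinary product s_{a_n} ⋯ s_{a_{i+1}} applied to a point (s_{a_{i+1}} acts first)
suffixProd : (a : List ℤ) → Fin (length a) → Perm
suffixProd a i x = foldl (λ y j → s j y) x (drop (toℕ i +ℕ 1) a)

-- γ_i(a) for a commutation i, as the two elements of the 2-element set
-- s_{a_n} ⋯ s_{a_{i+1}} ({a_i, a_i + 1})
gamma : (a : List ℤ) → Fin (length a) → ℤ × ℤ
gamma a i = suffixProd a i (lookup a i) , suffixProd a i (lookup a i + + 1)

SameSet : ℤ × ℤ → ℤ × ℤ → Set
SameSet (x , y) (u , v) = ((x ≡ u) × (y ≡ v)) ⊎' ((x ≡ v) × (y ≡ u))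
  where
  open import Data.Sum using () renaming (_⊎_ to _⊎'_)

-- {p,q} ∈ cyc(z) given as p < q = z(p); an unordered pair {x,y} lies in cyc(z)
InCyc : Perm → ℤ × ℤ → Set
InCyc z (x , y) = ((x < y) × (z x ≡ y)) ⊎' ((y < x) × (z y ≡ x))
  where
  open import Data.Sum using () renaming (_⊎_ to _⊎'_)

-- Induction on the reduced word, appending one letter c at a time. With y = invDem b, associativity
-- of the Demazure product, in the form (s_c ∘ σ) ∘ s_d = s_c ∘ (σ ∘ s_d), gives
-- invDem (b c) = s_c ∘ y ∘ s_c, which is one of three things. It is y when y (c+1) < y c, which
-- contradicts reducedness. It is y s_c = s_c y when y fixes c and c+1: then c is a commutation, its
-- γ is the new cycle {c, c+1}, and the old cycles and their γ's stay put because y moves their points.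
-- Otherwise it is s_c y s_c: c is not a commutation, and the cycles of the new involution as well as
-- the old γ's are the images of the old ones under s_c.
module Submission where

open import Defs
open import Data.Empty using (⊥; ⊥-elim)
open import Data.Fin using (Fin; toℕ; fromℕ<)
import Data.Fin.Properties as Fin
open import Data.Integer using (ℤ; _<_; _≤_; +_; _+_; _<?_; _≟_)
import Data.Integer.Properties as ℤ
open import Data.List using (List; []; _∷_; _∷ʳ_; _++_; foldl; reverse; length; take; drop; lookup)
import Data.List.Properties as List
open import Data.List.Reverse using (Reverse; []; _∶_∶ʳ_; reverseView)
open import Data.Nat using (ℕ; zero; suc; s≤s; s≤s⁻¹)
  renaming (_<_ to _<ℕ_; _≤_ to _≤ℕ_; _+_ to _+ℕ_)
import Data.Nat.Properties as ℕ
open import Data.Product using (_×_; _,_; proj₁; proj₂; map; ∃; Σ)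
open import Data.Sum using (_⊎_; inj₁; inj₂)
import Data.Sum as Sum
open import Function using (_∘_; id; case_of_)
open import Relation.Binary.Definitions using (tri<; tri≈; tri>)
open import Relation.Binary.PropositionalEquality
open import Relation.Nullary using (¬_; yes; no)
open import Relation.Nullary.Decidable using (_×-dec_)

-- Transpositions

i<i+1 : ∀ i → i < i + + 1
i<i+1 i = ℤ.suc[i]≤j⇒i<j (ℤ.≤-reflexive (ℤ.+-comm (+ 1) i))

i+1≮i : ∀ i → ¬ i + + 1 < i
i+1≮i i i+1<i = ℤ.<-asym i+1<i (i<i+1 i)

i<j⇒i+1≤j : ∀ {i j} → i < j → i + + 1 ≤ j
i<j⇒i+1≤j {i} i<j = subst (_≤ _) (ℤ.+-comm (+ 1) i) (ℤ.i<j⇒suc[i]≤j i<j)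

i<j+1⇒i≤j : ∀ {i j} → i < j + + 1 → i ≤ j
i<j+1⇒i≤j i<j+1 = ℤ.≮⇒≥ (λ j<i → ℤ.<⇒≱ i<j+1 (i<j⇒i+1≤j j<i))

s-at-i : ∀ i → s i i ≡ i + + 1
s-at-i i with i ≟ i
... | yes _ = refl
... | no i≢i = ⊥-elim (i≢i refl)

s-at-i+1 : ∀ i → s i (i + + 1) ≡ i
s-at-i+1 i with i + + 1 ≟ i
... | yes i+1≡i = ⊥-elim (ℤ.<⇒≢ (i<i+1 i) (sym i+1≡i))
... | no _ with i + + 1 ≟ i + + 1
...   | yes _ = refl
...   | no i+1≢i+1 = ⊥-elim (i+1≢i+1 refl)

s-off : ∀ i {x} → x ≢ i → x ≢ i + + 1 → s i x ≡ x
s-off i {x} x≢i x≢i+1 with x ≟ i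
... | yes x≡i = ⊥-elim (x≢i x≡i)
... | no _ with x ≟ i + + 1
...   | yes x≡i+1 = ⊥-elim (x≢i+1 x≡i+1)
...   | no _ = refl

data Position (i x : ℤ) : Set where
  at-i : x ≡ i → Position i x
  at-i+1 : x ≡ i + + 1 → Position i x
  off : x ≢ i → x ≢ i + + 1 → Position i x

position : ∀ i x → Position i x
position i x with x ≟ i
... | yes x≡i = at-i x≡i
... | no x≢i with x ≟ i + + 1
...   | yes x≡i+1 = at-i+1 x≡i+1
...   | no x≢i+1 = off x≢i x≢i+1

s-involutive : ∀ i x → s i (s i x) ≡ x
s-involutive i x with position i x
... | at-i refl = trans (cong (s i) (s-at-i i)) (s-at-i+1 i)
... | at-i+1 refl = trans (cong (s i) (s-at-i+1 i)) (s-at-i i)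
... | off x≢i x≢i+1 = trans (cong (s i) (s-off i x≢i x≢i+1)) (s-off i x≢i x≢i+1)

s-injective : ∀ i {x y} → s i x ≡ s i y → x ≡ y
s-injective i {x} {y} eq =
  trans (sym (s-involutive i x)) (trans (cong (s i) eq) (s-involutive i y))

s-reverses : ∀ i {x y} → x ≡ i → y ≡ i + + 1 → s i y < s i x
s-reverses i refl refl = subst₂ _<_ (sym (s-at-i+1 i)) (sym (s-at-i i)) (i<i+1 i)

s-monotone : ∀ i {x y} → ¬ (x ≡ i × y ≡ i + + 1) → x < y → s i x < s i y
s-monotone i {x} {y} ¬swap x<y with position i x | position i y
... | at-i refl | at-i refl = ⊥-elim (ℤ.<-irrefl refl x<y)
... | at-i refl | at-i+1 refl = ⊥-elim (¬swap (refl , refl))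
... | at-i refl | off y≢i y≢i+1 rewrite s-at-i i | s-off i y≢i y≢i+1 =
  ℤ.≤∧≢⇒< (i<j⇒i+1≤j x<y) (y≢i+1 ∘ sym)
... | at-i+1 refl | at-i refl = ⊥-elim (ℤ.<-asym x<y (i<i+1 i))
... | at-i+1 refl | at-i+1 refl = ⊥-elim (ℤ.<-irrefl refl x<y)
... | at-i+1 refl | off y≢i y≢i+1 rewrite s-at-i+1 i | s-off i y≢i y≢i+1 =
  ℤ.<-trans (i<i+1 i) x<y
... | off x≢i x≢i+1 | at-i refl rewrite s-at-i i | s-off i x≢i x≢i+1 =
  ℤ.<-trans x<y (i<i+1 i)
... | off x≢i x≢i+1 | at-i+1 refl rewrite s-at-i+1 i | s-off i x≢i x≢i+1 =
  ℤ.≤∧≢⇒< (i<j+1⇒i≤j x<y) x≢i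
... | off x≢i x≢i+1 | off y≢i y≢i+1 rewrite s-off i x≢i x≢i+1 | s-off i y≢i y≢i+1 = x<y

-- Inverses and the Demazure product

≐-refl : ∀ {σ} → σ ≐ σ
≐-refl _ = refl

≐-sym : ∀ {σ τ} → σ ≐ τ → τ ≐ σ
≐-sym eq x = sym (eq x)

≐-trans : ∀ {σ τ υ} → σ ≐ τ → τ ≐ υ → σ ≐ υ
≐-trans eq eq′ x = trans (eq x) (eq′ x)

record Inverse (σ ι : Perm) : Set where
  field
    inverseˡ : ∀ x → σ (ι x) ≡ x
    inverseʳ : ∀ x → ι (σ x) ≡ x

open Inverse

id-inverse : Inverse idP idP
id-inverse = record { inverseˡ = λ _ → refl ; inverseʳ = λ _ → refl }

involution⇒inverse : ∀ {y} → (∀ x → y (y x) ≡ x) → Inverse y y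
involution⇒inverse invol = record { inverseˡ = invol ; inverseʳ = invol }

inverse-flip : ∀ {σ ι} → Inverse σ ι → Inverse ι σ
inverse-flip inv = record { inverseˡ = inverseʳ inv ; inverseʳ = inverseˡ inv }

inverse-apply : ∀ {σ ι} → Inverse σ ι → ∀ {u v} → σ u ≡ v → ι v ≡ u
inverse-apply {ι = ι} inv {u} σu≡v = trans (cong ι (sym σu≡v)) (inverseʳ inv u)

inverse-injective : ∀ {σ ι} → Inverse σ ι → ∀ {u v} → σ u ≡ σ v → u ≡ v
inverse-injective inv σu≡σv = trans (sym (inverse-apply inv σu≡σv)) (inverseʳ inv _)

inverse-unique : ∀ {σ ι ι′} → Inverse σ ι → Inverse σ ι′ → ι ≐ ι′
inverse-unique {ι = ι} inv inv′ x = trans (cong ι (sym (inverseˡ inv′ x))) (inverseʳ inv _)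

inverse-resp-≐ : ∀ {σ σ′ ι} → σ ≐ σ′ → Inverse σ ι → Inverse σ′ ι
inverse-resp-≐ {ι = ι} eq inv = record
  { inverseˡ = λ x → trans (sym (eq _)) (inverseˡ inv x)
  ; inverseʳ = λ x → trans (cong ι (sym (eq x))) (inverseʳ inv x) }

ascent⇒< : ∀ {σ ι} → Inverse σ ι → ∀ d → ¬ σ (d + + 1) < σ d → σ d < σ (d + + 1)
ascent⇒< inv d ¬desc =
  ℤ.≤∧≢⇒< (ℤ.≮⇒≥ ¬desc) (λ eq → ℤ.<⇒≢ (i<i+1 d) (inverse-injective inv eq))

ascent⇒¬swap : ∀ {σ ι} → Inverse σ ι → ∀ {c d} → ¬ σ (d + + 1) < σ d →
               ¬ (ι (c + + 1) ≡ d × ι c ≡ d + + 1)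
ascent⇒¬swap inv {c} ¬desc (ιc+1≡d , ιc≡d+1) = ¬desc (subst₂ _<_
  (sym (inverse-apply (inverse-flip inv) ιc≡d+1)) (sym (inverse-apply (inverse-flip inv) ιc+1≡d))
  (i<i+1 c))

s-preserves-ascent : ∀ {σ ι} → Inverse σ ι → ∀ c d → ¬ σ (d + + 1) < σ d →
                     ¬ (σ d ≡ c × σ (d + + 1) ≡ c + + 1) → ¬ s c (σ (d + + 1)) < s c (σ d)
s-preserves-ascent inv c d ¬desc ¬aligned desc =
  ℤ.<-asym desc (s-monotone c ¬aligned (ascent⇒< inv d ¬desc))

s-conjugate : ∀ {σ ι} → Inverse σ ι → ∀ {c d} → σ d ≡ c → σ (d + + 1) ≡ c + + 1 →
              (λ x → s c (σ x)) ≐ (λ x → σ (s d x))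
s-conjugate {σ} inv {c} {d} σd≡c σd+1≡c+1 x with position d x
... | at-i refl =
  trans (cong (s c) σd≡c) (trans (s-at-i c) (trans (sym σd+1≡c+1) (cong σ (sym (s-at-i d)))))
... | at-i+1 refl =
  trans (cong (s c) σd+1≡c+1) (trans (s-at-i+1 c) (trans (sym σd≡c) (cong σ (sym (s-at-i+1 d)))))
... | off x≢d x≢d+1 =
  trans (s-off c (x≢d ∘ preimage σd≡c) (x≢d+1 ∘ preimage σd+1≡c+1)) (cong σ (sym (s-off d x≢d x≢d+1)))
  where
  preimage : ∀ {u v} → σ u ≡ v → σ x ≡ v → x ≡ u
  preimage σu≡v σx≡v = inverse-injective inv (trans σx≡v (sym σu≡v))

-- The left Demazure product s_c ∘ σ. Its descent test reads σ⁻¹, so the inverse ι of σ is passed along.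
demStepˡ : ℤ → Perm → Perm → Perm
demStepˡ c σ ι with ι (c + + 1) <? ι c
... | yes _ = σ
... | no _ = λ x → s c (σ x)

demStep-descent : ∀ {σ σ′} d → σ′ ≐ σ → σ (d + + 1) < σ d → demStep σ′ d ≐ σ
demStep-descent {σ′ = σ′} d eq desc x with σ′ (d + + 1) <? σ′ d
... | yes _ = eq x
... | no ¬desc = ⊥-elim (¬desc (subst₂ _<_ (sym (eq _)) (sym (eq _)) desc))

demStep-ascent : ∀ {σ σ′} d → σ′ ≐ σ → ¬ σ (d + + 1) < σ d → demStep σ′ d ≐ (λ x → σ (s d x))
demStep-ascent {σ′ = σ′} d eq ¬desc x with σ′ (d + + 1) <? σ′ d
... | yes desc = ⊥-elim (¬desc (subst₂ _<_ (eq _) (eq _) desc))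
... | no _ = eq (s d x)

demStepˡ-descent : ∀ {σ σ′ ι ι′} c → σ′ ≐ σ → ι′ ≐ ι → ι (c + + 1) < ι c → demStepˡ c σ′ ι′ ≐ σ
demStepˡ-descent {ι′ = ι′} c eq eqι desc x with ι′ (c + + 1) <? ι′ c
... | yes _ = eq x
... | no ¬desc = ⊥-elim (¬desc (subst₂ _<_ (sym (eqι _)) (sym (eqι _)) desc))

demStepˡ-ascent : ∀ {σ σ′ ι ι′} c → σ′ ≐ σ → ι′ ≐ ι → ¬ ι (c + + 1) < ι c →
                  demStepˡ c σ′ ι′ ≐ (λ x → s c (σ x))
demStepˡ-ascent {ι′ = ι′} c eq eqι ¬desc x with ι′ (c + + 1) <? ι′ c
... | yes desc = ⊥-elim (¬desc (subst₂ _<_ (eqι _) (eqι _) desc))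
... | no _ = cong (s c) (eq x)

demStep-cong : ∀ {σ σ′} d → σ ≐ σ′ → demStep σ d ≐ demStep σ′ d
demStep-cong {σ} d eq = case σ (d + + 1) <? σ d of λ where
  (yes desc) → ≐-trans (demStep-descent d (≐-refl {σ}) desc) (≐-sym (demStep-descent d (≐-sym eq) desc))
  (no ¬desc) → ≐-trans (demStep-ascent d (≐-refl {σ}) ¬desc) (≐-sym (demStep-ascent d (≐-sym eq) ¬desc))

demStepˡ-cong : ∀ {σ σ′ ι ι′} c → σ ≐ σ′ → ι ≐ ι′ → demStepˡ c σ ι ≐ demStepˡ c σ′ ι′
demStepˡ-cong {σ} {ι = ι} c eq eqι = case ι (c + + 1) <? ι c of λ where
  (yes desc) → ≐-trans (demStepˡ-descent c (≐-refl {σ}) (≐-refl {ι}) desc)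
                       (≐-sym (demStepˡ-descent c (≐-sym eq) (≐-sym eqι) desc))
  (no ¬desc) → ≐-trans (demStepˡ-ascent c (≐-refl {σ}) (≐-refl {ι}) ¬desc)
                       (≐-sym (demStepˡ-ascent c (≐-sym eq) (≐-sym eqι) ¬desc))

inverse-demStep : ∀ {σ ι} d → Inverse σ ι → Inverse (demStep σ d) (demStepˡ d ι σ)
inverse-demStep {σ} {ι} d inv with σ (d + + 1) <? σ d
... | yes _ = inv
... | no _ = record
  { inverseˡ = λ x → trans (cong σ (s-involutive d (ι x))) (inverseˡ inv x)
  ; inverseʳ = λ x → trans (cong (s d) (inverseʳ inv (s d x))) (s-involutive d x) }

demStepˡ-demStep-assoc : ∀ {σ ι} c d → Inverse σ ι →
                         demStep (demStepˡ c σ ι) d ≐ demStepˡ c (demStep σ d) (demStepˡ d ι σ)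
demStepˡ-demStep-assoc {σ} {ι} c d inv = case (ι (c + + 1) <? ι c) , (σ (d + + 1) <? σ d) of λ where
    (yes ιdesc , yes σdesc) →
      ≐-trans (demStep-descent d (demStepˡ-descent c σ≐ ι≐ ιdesc) σdesc)
              (≐-sym (demStepˡ-descent c (demStep-descent d σ≐ σdesc) (demStepˡ-descent d ι≐ σ≐ σdesc)
                                       ιdesc))
    (yes ιdesc , no σasc) →
      ≐-trans (demStep-ascent d (demStepˡ-descent c σ≐ ι≐ ιdesc) σasc)
              (≐-sym (demStepˡ-descent c (demStep-ascent d σ≐ σasc) (demStepˡ-ascent d ι≐ σ≐ σasc)
                                       (s-monotone d (ascent⇒¬swap inv σasc) ιdesc)))
    (no ιasc , yes σdesc) →
      ≐-trans (demStep-descent d (demStepˡ-ascent c σ≐ ι≐ ιasc)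
                               (s-monotone c (ascent⇒¬swap (inverse-flip inv) ιasc) σdesc))
              (≐-sym (demStepˡ-ascent c (demStep-descent d σ≐ σdesc) (demStepˡ-descent d ι≐ σ≐ σdesc)
                                      ιasc))
    (no ιasc , no σasc) → case (σ d ≟ c) ×-dec (σ (d + + 1) ≟ c + + 1) of λ where
      (yes (σd≡c , σd+1≡c+1)) →
        ≐-trans (demStep-descent d (demStepˡ-ascent c σ≐ ι≐ ιasc) (s-reverses c σd≡c σd+1≡c+1))
                (≐-trans (s-conjugate inv σd≡c σd+1≡c+1)
                         (≐-sym (demStepˡ-descent c (demStep-ascent d σ≐ σasc)
                                  (demStepˡ-ascent d ι≐ σ≐ σasc)
                                  (s-reverses d (inverse-apply inv σd≡c) (inverse-apply inv σd+1≡c+1)))))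
      (no ¬aligned) →
        ≐-trans (demStep-ascent d (demStepˡ-ascent c σ≐ ι≐ ιasc)
                                (s-preserves-ascent inv c d σasc ¬aligned))
                (≐-sym (demStepˡ-ascent c (demStep-ascent d σ≐ σasc) (demStepˡ-ascent d ι≐ σ≐ σasc)
                  (s-preserves-ascent (inverse-flip inv) d c ιasc
                    (λ (ιc≡d , ιc+1≡d+1) → ¬aligned (inverse-apply (inverse-flip inv) ιc≡d ,
                                                      inverse-apply (inverse-flip inv) ιc+1≡d+1)))))
  where
  σ≐ : σ ≐ σ
  σ≐ = ≐-refl
  ι≐ : ι ≐ ι
  ι≐ = ≐-refl

foldlInv : Perm → Perm → List ℤ → Perm
foldlInv σ ι [] = ι
foldlInv σ ι (d ∷ w) = foldlInv (demStep σ d) (demStepˡ d ι σ) w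

inverse-foldl : ∀ {σ ι} w → Inverse σ ι → Inverse (foldl demStep σ w) (foldlInv σ ι w)
inverse-foldl [] inv = inv
inverse-foldl (d ∷ w) inv = inverse-foldl w (inverse-demStep d inv)

foldl-demStep-cong : ∀ {σ σ′} w → σ ≐ σ′ → foldl demStep σ w ≐ foldl demStep σ′ w
foldl-demStep-cong [] eq = eq
foldl-demStep-cong (d ∷ w) eq = foldl-demStep-cong w (demStep-cong d eq)

foldl-demStepˡ : ∀ {σ ι} c w → Inverse σ ι →
                 foldl demStep (demStepˡ c σ ι) w ≐ demStepˡ c (foldl demStep σ w) (foldlInv σ ι w)
foldl-demStepˡ c [] inv = ≐-refl
foldl-demStepˡ c (d ∷ w) inv = ≐-trans (foldl-demStep-cong w (demStepˡ-demStep-assoc c d inv))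
                                       (foldl-demStepˡ c w (inverse-demStep d inv))

s≐demStep-id : ∀ c → s c ≐ demStep idP c
s≐demStep-id c = ≐-sym (demStep-ascent c (≐-refl {idP}) (i+1≮i c))

s≐demStepˡ-id : ∀ c → s c ≐ demStepˡ c idP idP
s≐demStepˡ-id c = ≐-sym (demStepˡ-ascent c (≐-refl {idP}) (≐-refl {idP}) (i+1≮i c))

invDem-inverse : ∀ b → Inverse (invDem b) (foldlInv idP idP (invWord b))
invDem-inverse b = inverse-foldl (invWord b) id-inverse

invWord-∷ʳ : ∀ b0 bs c → invWord ((b0 ∷ bs) ∷ʳ c) ≡ c ∷ (invWord (b0 ∷ bs) ∷ʳ c)
invWord-∷ʳ b0 bs c = begin
  reverse ((b0 ∷ bs) ∷ʳ c) ++ bs ∷ʳ c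
    ≡⟨ cong (_++ bs ∷ʳ c) (List.reverse-++ (b0 ∷ bs) (c ∷ [])) ⟩
  c ∷ reverse (b0 ∷ bs) ++ bs ∷ʳ c
    ≡⟨ cong (c ∷_) (sym (List.++-assoc (reverse (b0 ∷ bs)) bs (c ∷ []))) ⟩
  c ∷ (reverse (b0 ∷ bs) ++ bs) ∷ʳ c  ∎
  where open ≡-Reasoning

-- for b = [] the two words are c and cc, whose Demazure products agree
invDem-∷ʳ-word : ∀ b c → invDem (b ∷ʳ c) ≐ dem (c ∷ invWord b ∷ʳ c)
invDem-∷ʳ-word [] c = ≐-trans (≐-sym (s≐demStep-id c))
  (≐-sym (demStep-descent c (≐-sym (s≐demStep-id c)) (s-reverses c refl refl)))
invDem-∷ʳ-word (b0 ∷ bs) c x = cong (λ v → dem v x) (invWord-∷ʳ b0 bs c)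

-- the Demazure conjugate s_c ∘ y ∘ s_c, where ι is the inverse of y
demConj : ℤ → Perm → Perm → Perm
demConj c y ι = demStepˡ c (demStep y c) (demStepˡ c ι y)

demConj-cong : ∀ {y y′} c ι → y ≐ y′ → demConj c y ι ≐ demConj c y′ ι
demConj-cong c ι eq = demStepˡ-cong c (demStep-cong c eq) (demStepˡ-cong c (≐-refl {ι}) eq)

invDem-∷ʳ : ∀ b c {ι} → Inverse (invDem b) ι → invDem (b ∷ʳ c) ≐ demConj c (invDem b) ι
invDem-∷ʳ b c {ι} inv x = begin
  invDem (b ∷ʳ c) x
    ≡⟨ invDem-∷ʳ-word b c x ⟩
  foldl demStep (demStep idP c) (w ∷ʳ c) x
    ≡⟨ cong (λ f → f x) (List.foldl-∷ʳ demStep (demStep idP c) c w) ⟩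
  demStep (foldl demStep (demStep idP c) w) c x
    ≡⟨ demStep-cong c (foldl-demStep-cong w (≐-trans (≐-sym (s≐demStep-id c)) (s≐demStepˡ-id c))) x ⟩
  demStep (foldl demStep (demStepˡ c idP idP) w) c x
    ≡⟨ demStep-cong c (foldl-demStepˡ c w id-inverse) x ⟩
  demStep (demStepˡ c (invDem b) (foldlInv idP idP w)) c x
    ≡⟨ demStep-cong c (demStepˡ-cong c ≐-refl (inverse-unique (invDem-inverse b) inv)) x ⟩
  demStep (demStepˡ c (invDem b) ι) c x
    ≡⟨ demStepˡ-demStep-assoc c c inv x ⟩
  demConj c (invDem b) ι x ∎
  where
  open ≡-Reasoning
  w : List ℤ
  w = invWord b

invDem-∷ʳ-cong : ∀ b b′ c → invDem b′ ≐ invDem b → invDem (b′ ∷ʳ c) ≐ invDem (b ∷ʳ c)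
invDem-∷ʳ-cong b b′ c eq =
  ≐-trans (invDem-∷ʳ b′ c (inverse-resp-≐ (≐-sym eq) (invDem-inverse b)))
          (≐-trans (demConj-cong c _ eq) (≐-sym (invDem-∷ʳ b c (invDem-inverse b))))

module _ (c : ℤ) (y : Perm) where

  demConj-descent : y (c + + 1) < y c → demConj c y y ≐ y
  demConj-descent desc = demStepˡ-descent c (demStep-descent c (≐-refl {y}) desc)
                                            (demStepˡ-descent c (≐-refl {y}) (≐-refl {y}) desc) desc

  demConj-fixed : y c ≡ c → y (c + + 1) ≡ c + + 1 → demConj c y y ≐ (λ x → y (s c x))
  demConj-fixed yc≡c yc+1≡c+1 = demStepˡ-descent c (demStep-ascent c (≐-refl {y}) ¬desc)
    (demStepˡ-ascent c (≐-refl {y}) (≐-refl {y}) ¬desc) (s-reverses c yc≡c yc+1≡c+1)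
    where
    ¬desc : ¬ y (c + + 1) < y c
    ¬desc = subst₂ (λ u v → ¬ u < v) (sym yc+1≡c+1) (sym yc≡c) (i+1≮i c)

  demConj-twisted : Inverse y y → ¬ y (c + + 1) < y c → ¬ (y c ≡ c × y (c + + 1) ≡ c + + 1) →
                    demConj c y y ≐ (λ x → s c (y (s c x)))
  demConj-twisted inv ¬desc ¬fixed = demStepˡ-ascent c (demStep-ascent c (≐-refl {y}) ¬desc)
    (demStepˡ-ascent c (≐-refl {y}) (≐-refl {y}) ¬desc) (s-preserves-ascent inv c c ¬desc ¬fixed)

-- Commutations of a word

-- the k-th letter, with a junk value beyond the end of the word
nth : List ℤ → ℕ → ℤ
nth [] _ = + 0
nth (x ∷ xs) zero = x
nth (x ∷ xs) (suc k) = nth xs k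

length-∷ʳ : ∀ (b : List ℤ) c → length (b ∷ʳ c) ≡ suc (length b)
length-∷ʳ [] c = refl
length-∷ʳ (x ∷ b) c = cong suc (length-∷ʳ b c)

nth-++ˡ : ∀ b ys {k} → k <ℕ length b → nth (b ++ ys) k ≡ nth b k
nth-++ˡ (x ∷ b) ys {zero} _ = refl
nth-++ˡ (x ∷ b) ys {suc k} (s≤s k<) = nth-++ˡ b ys k<

nth-length : ∀ b c → nth (b ∷ʳ c) (length b) ≡ c
nth-length [] c = refl
nth-length (x ∷ b) c = nth-length b c

take-++ˡ : ∀ b (ys : List ℤ) {k} → k ≤ℕ length b → take k (b ++ ys) ≡ take k b
take-++ˡ b ys {zero} _ = refl
take-++ˡ (x ∷ b) ys {suc k} (s≤s k≤) = cong (x ∷_) (take-++ˡ b ys k≤)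

take-length : ∀ (b ys : List ℤ) → take (length b) (b ++ ys) ≡ b
take-length [] ys = refl
take-length (x ∷ b) ys = cong (x ∷_) (take-length b ys)

drop-++ˡ : ∀ b (ys : List ℤ) {k} → k ≤ℕ length b → drop k (b ++ ys) ≡ drop k b ++ ys
drop-++ˡ b ys {zero} _ = refl
drop-++ˡ (x ∷ b) ys {suc k} (s≤s k≤) = drop-++ˡ b ys k≤

index-∷ʳ : ∀ b c {k} → k <ℕ length (b ∷ʳ c) → k <ℕ length b ⊎ k ≡ length b
index-∷ʳ b c k< = ℕ.m<1+n⇒m<n∨m≡n (subst (_ <ℕ_) (length-∷ʳ b c) k<)

<-∷ʳ : ∀ b c {k} → k <ℕ length b → k <ℕ length (b ∷ʳ c)
<-∷ʳ b c k< = subst (_ <ℕ_) (sym (length-∷ʳ b c)) (ℕ.m<n⇒m<1+n k<)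

length<length-∷ʳ : ∀ b c → length b <ℕ length (b ∷ʳ c)
length<length-∷ʳ b c = subst (length b <ℕ_) (sym (length-∷ʳ b c)) (ℕ.n<1+n (length b))

Commutes : ℤ → Perm → Set
Commutes c τ = ∀ x → s c (τ x) ≡ τ (s c x)

CommutationAt : List ℤ → ℕ → Set
CommutationAt a k = Commutes (nth a k) (invDem (take k a))

suffixAct : List ℤ → ℤ → ℤ
suffixAct w x = foldl (λ y j → s j y) x w

mapBoth : (ℤ → ℤ) → ℤ × ℤ → ℤ × ℤ
mapBoth f = map f f

γ : List ℤ → ℕ → ℤ × ℤ
γ a k = mapBoth (suffixAct (drop (k +ℕ 1) a)) (nth a k , nth a k + + 1)

module _ (b : List ℤ) (c : ℤ) where

  CommutationAt-∷ʳ : ∀ {k} → k <ℕ length b → CommutationAt (b ∷ʳ c) k ≡ CommutationAt b k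
  CommutationAt-∷ʳ k< =
    cong₂ (λ n t → Commutes n (invDem t)) (nth-++ˡ b (c ∷ []) k<) (take-++ˡ b (c ∷ []) (ℕ.<⇒≤ k<))

  commutation-∷ʳ⁻ : ∀ {k} → k <ℕ length b → CommutationAt (b ∷ʳ c) k → CommutationAt b k
  commutation-∷ʳ⁻ k< = subst id (CommutationAt-∷ʳ k<)

  commutation-∷ʳ⁺ : ∀ {k} → k <ℕ length b → CommutationAt b k → CommutationAt (b ∷ʳ c) k
  commutation-∷ʳ⁺ k< = subst id (sym (CommutationAt-∷ʳ k<))

  CommutationAt-last : CommutationAt (b ∷ʳ c) (length b) ≡ Commutes c (invDem b)
  CommutationAt-last = cong₂ (λ n t → Commutes n (invDem t)) (nth-length b c) (take-length b (c ∷ []))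

  γ-∷ʳ : ∀ {k} → k <ℕ length b → γ (b ∷ʳ c) k ≡ mapBoth (s c) (γ b k)
  γ-∷ʳ {k} k< rewrite nth-++ˡ b (c ∷ []) k< = cong₂ _,_ (suffixAct-∷ʳ _) (suffixAct-∷ʳ _)
    where
    suffixAct-∷ʳ : ∀ x → suffixAct (drop (k +ℕ 1) (b ∷ʳ c)) x ≡ s c (suffixAct (drop (k +ℕ 1) b) x)
    suffixAct-∷ʳ x =
      trans (cong (λ w → suffixAct w x) (drop-++ˡ b (c ∷ []) (subst (_≤ℕ length b) (ℕ.+-comm 1 k) k<)))
            (List.foldl-∷ʳ (λ y j → s j y) x c (drop (k +ℕ 1) b))

  γ-last : γ (b ∷ʳ c) (length b) ≡ (c , c + + 1)
  γ-last rewrite List.drop-all (length b +ℕ 1) (b ∷ʳ c) (ℕ.≤-reflexive (List.length-++ b))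
               | nth-length b c = refl

SameSet-sym : ∀ {g h} → SameSet g h → SameSet h g
SameSet-sym {_ , _} {_ , _} (inj₁ (eq₁ , eq₂)) = inj₁ (sym eq₁ , sym eq₂)
SameSet-sym {_ , _} {_ , _} (inj₂ (eq₁ , eq₂)) = inj₂ (sym eq₂ , sym eq₁)

SameSet-swap : ∀ {g p q} → SameSet g (p , q) → SameSet g (q , p)
SameSet-swap {_ , _} (inj₁ eqs) = inj₂ eqs
SameSet-swap {_ , _} (inj₂ eqs) = inj₁ eqs

SameSet-map : ∀ f {g h} → SameSet g h → SameSet (mapBoth f g) (mapBoth f h)
SameSet-map f {_ , _} {_ , _} (inj₁ (eq₁ , eq₂)) = inj₁ (cong f eq₁ , cong f eq₂)
SameSet-map f {_ , _} {_ , _} (inj₂ (eq₁ , eq₂)) = inj₂ (cong f eq₁ , cong f eq₂)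

SameSet-s⁻¹ : ∀ c {g h} → SameSet (mapBoth (s c) g) (mapBoth (s c) h) → SameSet g h
SameSet-s⁻¹ c {_ , _} {_ , _} (inj₁ (eq₁ , eq₂)) = inj₁ (s-injective c eq₁ , s-injective c eq₂)
SameSet-s⁻¹ c {_ , _} {_ , _} (inj₂ (eq₁ , eq₂)) = inj₂ (s-injective c eq₁ , s-injective c eq₂)

SameSet-s : ∀ c {g p q} → SameSet g (s c p , s c q) → SameSet (mapBoth (s c) g) (p , q)
SameSet-s c {g} {p} {q} same = subst₂ (λ u v → SameSet (mapBoth (s c) g) (u , v))
  (s-involutive c p) (s-involutive c q) (SameSet-map (s c) same)

InCyc-resp : ∀ {σ σ′ u v} → σ u ≡ σ′ u → σ v ≡ σ′ v → InCyc σ (u , v) → InCyc σ′ (u , v)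
InCyc-resp eq₁ eq₂ (inj₁ (u<v , σu≡v)) = inj₁ (u<v , trans (sym eq₁) σu≡v)
InCyc-resp eq₁ eq₂ (inj₂ (v<u , σv≡u)) = inj₂ (v<u , trans (sym eq₂) σv≡u)

InCyc-moved : ∀ {y u v} → Inverse y y → InCyc y (u , v) → y u ≢ u × y v ≢ v
InCyc-moved inv (inj₁ (u<v , yu≡v)) =
  (λ yu≡u → ℤ.<⇒≢ u<v (trans (sym yu≡u) yu≡v)) ,
  (λ yv≡v → ℤ.<⇒≢ u<v (trans (sym (inverse-apply inv yu≡v)) yv≡v))
InCyc-moved inv (inj₂ (v<u , yv≡u)) =
  (λ yu≡u → ℤ.<⇒≢ v<u (trans (sym (inverse-apply inv yv≡u)) yu≡u)) ,
  (λ yv≡v → ℤ.<⇒≢ v<u (trans (sym yv≡v) yv≡u))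

-- The induction on reduced words

Reduced : List ℤ → Set
Reduced a = ∀ b → invDem b ≐ invDem a → length a ≤ℕ length b

Reduced-∷ʳ⁻ : ∀ b c → Reduced (b ∷ʳ c) → Reduced b
Reduced-∷ʳ⁻ b c red b′ eq = s≤s⁻¹
  (subst₂ _≤ℕ_ (length-∷ʳ b c) (length-∷ʳ b′ c) (red (b′ ∷ʳ c) (invDem-∷ʳ-cong b b′ c eq)))

γ-Fibre : List ℤ → ℤ × ℤ → Set
γ-Fibre a g = ∃ λ k → k <ℕ length a × CommutationAt a k × SameSet (γ a k) g

MapsIntoCyc : List ℤ → Set
MapsIntoCyc a = ∀ {k} → k <ℕ length a → CommutationAt a k → InCyc (invDem a) (γ a k)

InjectiveOnCommutations : List ℤ → Set
InjectiveOnCommutations a = ∀ {k l} → k <ℕ length a → l <ℕ length a →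
  CommutationAt a k → CommutationAt a l → SameSet (γ a k) (γ a l) → k ≡ l

OntoCyc : List ℤ → Set
OntoCyc a = ∀ {p q} → p < q → invDem a p ≡ q → γ-Fibre a (p , q)

record CycleBijection (a : List ℤ) : Set where
  field
    involutive : Inverse (invDem a) (invDem a)
    γ-cycle : MapsIntoCyc a
    γ-injective : InjectiveOnCommutations a
    γ-surjective : OntoCyc a

CycleBijection-[] : CycleBijection []
CycleBijection-[] = record
  { involutive = id-inverse
  ; γ-cycle = λ ()
  ; γ-injective = λ ()
  ; γ-surjective = λ p<q p≡q → ⊥-elim (ℤ.<⇒≢ p<q p≡q) }

module Commuting (b : List ℤ) (c : ℤ) (B : CycleBijection b)
                 (yc≡c : invDem b c ≡ c) (yc+1≡c+1 : invDem b (c + + 1) ≡ c + + 1) where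
  open CycleBijection B

  y y′ : Perm
  y = invDem b
  y′ = invDem (b ∷ʳ c)

  y′≐y∘s : y′ ≐ (λ x → y (s c x))
  y′≐y∘s = ≐-trans (invDem-∷ʳ b c involutive) (demConj-fixed c y yc≡c yc+1≡c+1)

  commutes : Commutes c y
  commutes = s-conjugate involutive yc≡c yc+1≡c+1

  y-fixes : ∀ {u} → u ≡ c ⊎ u ≡ c + + 1 → y u ≡ u
  y-fixes (inj₁ refl) = yc≡c
  y-fixes (inj₂ refl) = yc+1≡c+1

  s-fixes-moved : ∀ {u} → y u ≢ u → s c u ≡ u
  s-fixes-moved yu≢u = s-off c (yu≢u ∘ y-fixes ∘ inj₁) (yu≢u ∘ y-fixes ∘ inj₂)

  cycle-persists : ∀ {u v} → InCyc y (u , v) → mapBoth (s c) (u , v) ≡ (u , v) × InCyc y′ (u , v)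
  cycle-persists cyc with InCyc-moved involutive cyc
  ... | yu≢u , yv≢v = cong₂ _,_ (s-fixes-moved yu≢u) (s-fixes-moved yv≢v) ,
                      InCyc-resp (agrees yu≢u) (agrees yv≢v) cyc
    where
    agrees : ∀ {u} → y u ≢ u → y u ≡ y′ u
    agrees yu≢u = sym (trans (y′≐y∘s _) (cong y (s-fixes-moved yu≢u)))

  γ-∷ʳ-old : ∀ {k} → k <ℕ length b → CommutationAt b k → γ (b ∷ʳ c) k ≡ γ b k
  γ-∷ʳ-old k< cm = trans (γ-∷ʳ b c k<) (proj₁ (cycle-persists (γ-cycle k< cm)))

  last-is-new : ∀ {k} → k <ℕ length b → CommutationAt b k → ¬ SameSet (γ b k) (c , c + + 1)
  last-is-new k< cm same =
    proj₁ (InCyc-moved involutive (γ-cycle k< cm)) (y-fixes (Sum.map proj₁ proj₁ same))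

  involutive′ : Inverse y′ y′
  involutive′ = involution⇒inverse λ x → begin
    y′ (y′ x)              ≡⟨ y′≐y∘s (y′ x) ⟩
    y (s c (y′ x))         ≡⟨ cong (y ∘ s c) (y′≐y∘s x) ⟩
    y (s c (y (s c x)))    ≡⟨ cong y (commutes (s c x)) ⟩
    y (y (s c (s c x)))    ≡⟨ inverseʳ involutive _ ⟩
    s c (s c x)            ≡⟨ s-involutive c x ⟩
    x                      ∎
    where open ≡-Reasoning

  γ-cycle′ : MapsIntoCyc (b ∷ʳ c)
  γ-cycle′ {k} k< cm with index-∷ʳ b c k<
  ... | inj₁ k<b =
    subst (InCyc y′) (sym (γ-∷ʳ-old k<b cm′)) (proj₂ (cycle-persists (γ-cycle k<b cm′)))
    where
    cm′ : CommutationAt b k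
    cm′ = commutation-∷ʳ⁻ b c k<b cm
  ... | inj₂ refl = subst (InCyc y′) (sym (γ-last b c))
    (inj₁ (i<i+1 c , trans (y′≐y∘s c) (trans (cong y (s-at-i c)) yc+1≡c+1)))

  γ-injective′ : InjectiveOnCommutations (b ∷ʳ c)
  γ-injective′ {k} {l} k< l< cmk cml same with index-∷ʳ b c k< | index-∷ʳ b c l<
  ... | inj₁ k<b | inj₁ l<b = γ-injective k<b l<b cmk′ cml′
          (subst₂ SameSet (γ-∷ʳ-old k<b cmk′) (γ-∷ʳ-old l<b cml′) same)
    where
    cmk′ : CommutationAt b k
    cmk′ = commutation-∷ʳ⁻ b c k<b cmk
    cml′ : CommutationAt b l
    cml′ = commutation-∷ʳ⁻ b c l<b cml
  ... | inj₁ k<b | inj₂ refl = ⊥-elim (last-is-new k<b cmk′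
          (subst₂ SameSet (γ-∷ʳ-old k<b cmk′) (γ-last b c) same))
    where
    cmk′ : CommutationAt b k
    cmk′ = commutation-∷ʳ⁻ b c k<b cmk
  ... | inj₂ refl | inj₁ l<b = ⊥-elim (last-is-new l<b cml′
          (subst₂ SameSet (γ-∷ʳ-old l<b cml′) (γ-last b c) (SameSet-sym same)))
    where
    cml′ : CommutationAt b l
    cml′ = commutation-∷ʳ⁻ b c l<b cml
  ... | inj₂ refl | inj₂ refl = refl

  γ-surjective′ : OntoCyc (b ∷ʳ c)
  γ-surjective′ {p} {q} p<q y′p≡q with position c p
  ... | at-i refl = length b , length<length-∷ʳ b c , subst id (sym (CommutationAt-last b c)) commutes ,
                    subst (λ g → SameSet g (p , q)) (sym (γ-last b c)) (inj₁ (refl , sym q≡c+1))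
    where
    q≡c+1 : q ≡ c + + 1
    q≡c+1 = trans (sym y′p≡q) (trans (y′≐y∘s c) (trans (cong y (s-at-i c)) yc+1≡c+1))
  ... | at-i+1 refl = ⊥-elim (i+1≮i c (subst (c + + 1 <_) q≡c p<q))
    where
    q≡c : q ≡ c
    q≡c = trans (sym y′p≡q) (trans (y′≐y∘s (c + + 1)) (trans (cong y (s-at-i+1 c)) yc≡c))
  ... | off p≢c p≢c+1 with γ-surjective p<q (trans (sym y′p≡yp) y′p≡q)
    where
    y′p≡yp : y′ p ≡ y p
    y′p≡yp = trans (y′≐y∘s p) (cong y (s-off c p≢c p≢c+1))
  ...   | k , k< , cm , same = k , <-∷ʳ b c k< , commutation-∷ʳ⁺ b c k< cm ,
                                subst (λ g → SameSet g (p , q)) (sym (γ-∷ʳ-old k< cm)) same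

  cycleBijection : CycleBijection (b ∷ʳ c)
  cycleBijection = record { involutive = involutive′ ; γ-cycle = γ-cycle′
                          ; γ-injective = γ-injective′ ; γ-surjective = γ-surjective′ }

module Twisting (b : List ℤ) (c : ℤ) (B : CycleBijection b)
                (¬desc : ¬ invDem b (c + + 1) < invDem b c)
                (¬fixed : ¬ (invDem b c ≡ c × invDem b (c + + 1) ≡ c + + 1)) where
  open CycleBijection B

  y y′ : Perm
  y = invDem b
  y′ = invDem (b ∷ʳ c)

  y′≐s∘y∘s : y′ ≐ (λ x → s c (y (s c x)))
  y′≐s∘y∘s = ≐-trans (invDem-∷ʳ b c involutive) (demConj-twisted c y involutive ¬desc ¬fixed)

  y∘s≡s∘y′ : ∀ x → y (s c x) ≡ s c (y′ x)
  y∘s≡s∘y′ x = trans (sym (s-involutive c _)) (cong (s c) (sym (y′≐s∘y∘s x)))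

  yc≢c+1 : y c ≢ c + + 1
  yc≢c+1 yc≡c+1 = ¬desc (subst₂ _<_ (sym (inverse-apply involutive yc≡c+1)) (sym yc≡c+1) (i<i+1 c))

  -- y c < y (c+1) = s_c (y c) would force y c = c
  ¬commutes : ¬ Commutes c y
  ¬commutes commutes = excluded (position c (y c))
    where
    yc+1≡s[yc] : y (c + + 1) ≡ s c (y c)
    yc+1≡s[yc] = trans (cong y (sym (s-at-i c))) (sym (commutes c))
    excluded : Position c (y c) → ⊥
    excluded (at-i yc≡c) = ¬fixed (yc≡c , trans yc+1≡s[yc] (trans (cong (s c) yc≡c) (s-at-i c)))
    excluded (at-i+1 yc≡c+1) = yc≢c+1 yc≡c+1
    excluded (off yc≢c yc≢c+1) =
      ℤ.<⇒≢ (ascent⇒< involutive c ¬desc) (sym (trans yc+1≡s[yc] (s-off c yc≢c yc≢c+1)))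

  involutive′ : Inverse y′ y′
  involutive′ = involution⇒inverse λ x → begin
    y′ (y′ x)                          ≡⟨ y′≐s∘y∘s (y′ x) ⟩
    s c (y (s c (y′ x)))               ≡⟨ cong (s c ∘ y ∘ s c) (y′≐s∘y∘s x) ⟩
    s c (y (s c (s c (y (s c x)))))    ≡⟨ cong (s c ∘ y) (s-involutive c _) ⟩
    s c (y (y (s c x)))                ≡⟨ cong (s c) (inverseʳ involutive _) ⟩
    s c (s c x)                        ≡⟨ s-involutive c x ⟩
    x                                  ∎
    where open ≡-Reasoning

  s-maps-oriented : ∀ {u v} → u < v → y u ≡ v → s c u < s c v × y′ (s c u) ≡ s c v
  s-maps-oriented {u} {v} u<v yu≡v =
    s-monotone c (λ (u≡c , v≡c+1) → yc≢c+1 (trans (cong y (sym u≡c)) (trans yu≡v v≡c+1))) u<v ,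
    trans (y′≐s∘y∘s (s c u)) (cong (s c) (trans (cong y (s-involutive c u)) yu≡v))

  s-maps-cycle : ∀ {u v} → InCyc y (u , v) → InCyc y′ (s c u , s c v)
  s-maps-cycle (inj₁ (u<v , yu≡v)) = inj₁ (s-maps-oriented u<v yu≡v)
  s-maps-cycle (inj₂ (v<u , yv≡u)) = inj₂ (s-maps-oriented v<u yv≡u)

  γ-cycle′ : MapsIntoCyc (b ∷ʳ c)
  γ-cycle′ {k} k< cm with index-∷ʳ b c k<
  ... | inj₁ k<b =
    subst (InCyc y′) (sym (γ-∷ʳ b c k<b)) (s-maps-cycle (γ-cycle k<b (commutation-∷ʳ⁻ b c k<b cm)))
  ... | inj₂ refl = ⊥-elim (¬commutes (subst id (CommutationAt-last b c) cm))

  γ-injective′ : InjectiveOnCommutations (b ∷ʳ c)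
  γ-injective′ {k} {l} k< l< cmk cml same with index-∷ʳ b c k< | index-∷ʳ b c l<
  ... | inj₁ k<b | inj₁ l<b =
    γ-injective k<b l<b (commutation-∷ʳ⁻ b c k<b cmk) (commutation-∷ʳ⁻ b c l<b cml)
                (SameSet-s⁻¹ c (subst₂ SameSet (γ-∷ʳ b c k<b) (γ-∷ʳ b c l<b) same))
  ... | inj₂ refl | _ = ⊥-elim (¬commutes (subst id (CommutationAt-last b c) cmk))
  ... | _ | inj₂ refl = ⊥-elim (¬commutes (subst id (CommutationAt-last b c) cml))

  fibre-∷ʳ : ∀ {u v} → γ-Fibre b (s c u , s c v) → γ-Fibre (b ∷ʳ c) (u , v)
  fibre-∷ʳ (k , k< , cm , same) = k , <-∷ʳ b c k< , commutation-∷ʳ⁺ b c k< cm ,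
                                  subst (λ g → SameSet g _) (sym (γ-∷ʳ b c k<)) (SameSet-s c same)

  γ-surjective′ : OntoCyc (b ∷ʳ c)
  γ-surjective′ {p} {q} p<q y′p≡q with ℤ.<-cmp (s c p) (s c q)
  ... | tri< sp<sq _ _ = fibre-∷ʳ (γ-surjective sp<sq ysp≡sq)
    where
    ysp≡sq : y (s c p) ≡ s c q
    ysp≡sq = trans (y∘s≡s∘y′ p) (cong (s c) y′p≡q)
  ... | tri≈ _ sp≡sq _ = ⊥-elim (ℤ.<⇒≢ p<q (s-injective c sp≡sq))
  ... | tri> _ _ sq<sp with fibre-∷ʳ (γ-surjective sq<sp (inverse-apply involutive ysp≡sq))
    where
    ysp≡sq : y (s c p) ≡ s c q
    ysp≡sq = trans (y∘s≡s∘y′ p) (cong (s c) y′p≡q)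
  ...   | k , k< , cm , same = k , k< , cm , SameSet-swap same

  cycleBijection : CycleBijection (b ∷ʳ c)
  cycleBijection = record { involutive = involutive′ ; γ-cycle = γ-cycle′
                          ; γ-injective = γ-injective′ ; γ-surjective = γ-surjective′ }

CycleBijection-∷ʳ : ∀ b c → Reduced (b ∷ʳ c) → CycleBijection b → CycleBijection (b ∷ʳ c)
CycleBijection-∷ʳ b c red B with invDem b (c + + 1) <? invDem b c
... | yes desc = ⊥-elim (ℕ.1+n≰n (subst (_≤ℕ length b) (length-∷ʳ b c) (red b (≐-sym unchanged))))
  where
  unchanged : invDem (b ∷ʳ c) ≐ invDem b
  unchanged = ≐-trans (invDem-∷ʳ b c (CycleBijection.involutive B)) (demConj-descent c (invDem b) desc)
... | no ¬desc with (invDem b c ≟ c) ×-dec (invDem b (c + + 1) ≟ c + + 1)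
...   | yes (yc≡c , yc+1≡c+1) = Commuting.cycleBijection b c B yc≡c yc+1≡c+1
...   | no ¬fixed = Twisting.cycleBijection b c B ¬desc ¬fixed

reduced⇒CycleBijection : ∀ a → Reduced a → CycleBijection a
reduced⇒CycleBijection a = go (reverseView a)
  where
  go : ∀ {a} → Reverse a → Reduced a → CycleBijection a
  go [] _ = CycleBijection-[]
  go (b ∶ rb ∶ʳ c) red = CycleBijection-∷ʳ b c red (go rb (Reduced-∷ʳ⁻ b c red))

lookup≡nth : ∀ a (i : Fin (length a)) → lookup a i ≡ nth a (toℕ i)
lookup≡nth (x ∷ a) Fin.zero = refl
lookup≡nth (x ∷ a) (Fin.suc i) = lookup≡nth a i

IsCommutation≡CommutationAt : ∀ a i {k} → toℕ i ≡ k → IsCommutation a i ≡ CommutationAt a k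
IsCommutation≡CommutationAt a i refl = cong (λ n → Commutes n (invDem (take (toℕ i) a))) (lookup≡nth a i)

gamma≡γ : ∀ a i {k} → toℕ i ≡ k → gamma a i ≡ γ a k
gamma≡γ a i refl = cong (λ n → mapBoth (suffixAct (drop (toℕ i +ℕ 1) a)) (n , n + + 1)) (lookup≡nth a i)

proposition3p27 : (z : Perm) → IsInvolutionZ z → (a : List ℤ) → Rinv z a →
      ((i : Fin (length a)) → IsCommutation a i → InCyc z (gamma a i))
    × ((i j : Fin (length a)) → IsCommutation a i → IsCommutation a j →
         SameSet (gamma a i) (gamma a j) → i ≡ j)
    × ((p q : ℤ) → p < q → z p ≡ q →
         Σ (Fin (length a)) (λ i → IsCommutation a i × SameSet (gamma a i) (p , q)))
proposition3p27 z _ a (invDem≐z , minimal) = into-cyc , injective , onto-cyc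
  where
  open CycleBijection (reduced⇒CycleBijection a λ b eq → minimal b (≐-trans eq invDem≐z))

  commutationAt : ∀ i → IsCommutation a i → CommutationAt a (toℕ i)
  commutationAt i = subst id (IsCommutation≡CommutationAt a i refl)

  into-cyc : ∀ i → IsCommutation a i → InCyc z (gamma a i)
  into-cyc i cm = subst (InCyc z) (sym (gamma≡γ a i refl))
    (InCyc-resp {invDem a} {z} (invDem≐z _) (invDem≐z _) (γ-cycle (Fin.toℕ<n i) (commutationAt i cm)))

  injective : ∀ i j → IsCommutation a i → IsCommutation a j → SameSet (gamma a i) (gamma a j) → i ≡ j
  injective i j cmi cmj same = Fin.toℕ-injective
    (γ-injective (Fin.toℕ<n i) (Fin.toℕ<n j) (commutationAt i cmi) (commutationAt j cmj)
                 (subst₂ SameSet (gamma≡γ a i refl) (gamma≡γ a j refl) same))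

  onto-cyc : ∀ p q → p < q → z p ≡ q →
             Σ (Fin (length a)) (λ i → IsCommutation a i × SameSet (gamma a i) (p , q))
  onto-cyc p q p<q zp≡q with γ-surjective p<q (trans (invDem≐z p) zp≡q)
  ... | k , k< , cm , same =
    fromℕ< k< , subst id (sym (IsCommutation≡CommutationAt a _ (Fin.toℕ-fromℕ< k<))) cm ,
    subst (λ g → SameSet g (p , q)) (sym (gamma≡γ a _ (Fin.toℕ-fromℕ< k<))) same
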